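{- Suppose an evaluator has accuracy $\alpha$ on a balanced dataset $X$ of size $N$ with binary labels $Y=\{0,1\}$. Assume the evaluator always lies on any $x\in X$ if and only if it incorrectly labels that datapoint. Then if the No-Data Algorithm is run with flip probability $\phi$ and the EV protocol is run for $r$ rounds, the expected accuracy of the No-Data Algorithm on $X$ satisfies $$\mathrm{E}[\text{correct}] \le 1-(1-\alpha)\left(1-\phi+\phi\left(\tfrac14\right)^r\right).$$
   Context: Datapoints are binary strings $x\in X\subset\{0,1\}^n$, labels in $Y=\{0,1\}$, and there is an unknown true labelling $f\colon X\to Y$. A criterion is a map $c\colon X\to\{0,1\}$; a rubric is given by ordered criteria $\mathcal{C}=\{c_1,\dots,c_n\}$ and $C(x)=c_1(x)|\cdots|c_n(x)$. The total rubric $\bar{\mathcal{C}}$ additionally contains the constituent clauses of every nonlinear criterion of arity $>1$. An aggregator is $\sigma\colon\{0,1\}^n\to Y$, and $f=\sigma\circ C$. For each string $x$, $S_x$ is a fixed set of relevant substrings of $x$. EV protocol on input $x$ (evaluator $E$, verifier $V$, rubric $C$, $r$ rounds): in each round the evaluator produces $x'$ and a partial label $\tilde y'$; the verifier chooses uniformly at random one of two challenges: Challenge 1 checks $\forall s\in S_x\,\exists t\in S_{x'}\,\forall c\in\bar{\mathcal{C}}:\ c(s)=c(t)$; Challenge 2 checks $C(x')=C(x)$. On a failed challenge the protocol returns (failure, $\tilde y'$); after $r$ passed rounds it returns (success, $\tilde y'$). An evaluator that knows $f$ always passes; an evaluator that lies (does not know the label) evades detection in a round with probability $1/4$. No-Data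 Algorithm: for each $x\in X$, run the EV protocol for $r$ rounds obtaining (success, $y$). If success, output label $y$ and record a success; otherwise output $\neg y$ with probability $\phi$ (and $y$ otherwise) and record a failure. Return the list of output labels and the list of successes. Its accuracy is the fraction of output labels equal to $f(x)$.
   Formalization: The flip probability $\phi$ ranges over the rationals in [0,1], so the distribution of the No-Data Algorithm's outputs has rational weights. -}

module Defs where

open import Data.Bool using (Bool; true; false; not; if_then_else_; _∧_)
open import Data.Nat using (ℕ; zero; suc; NonZero)
open import Data.Integer using (+_)
open import Data.List using (List; []; _∷_; map; concatMap)
open import Data.Product using (_×_; _,_)
open import Data.Vec using (Vec)
open import Data.Rational using (ℚ; _/_; 0ℚ; 1ℚ; _+_; _*_; _-_)
open import Relation.Binary.PropositionalEquality using (_≡_)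

Dist : Set → Set
Dist A = List (ℚ × A)

return : {A : Set} → A → Dist A
return a = (1ℚ , a) ∷ []

_>>=_ : {A B : Set} → Dist A → (A → Dist B) → Dist B
d >>= k = concatMap (λ { (p , a) → map (λ { (q , b) → (p * q , b) }) (k a) }) d

bernoulli : ℚ → Dist Bool
bernoulli p = (p , true) ∷ (1ℚ - p , false) ∷ []

𝔼 : {A : Set} → Dist A → (A → ℚ) → ℚ
𝔼 [] h = 0ℚ
𝔼 ((p , a) ∷ d) h = p * h a + 𝔼 d h

¼ : ℚ
¼ = + 1 / 4

_^ℚ_ : ℚ → ℕ → ℚ
q ^ℚ zero = 1ℚ
q ^ℚ suc n = q * (q ^ℚ n)

count : {A : Set} → (A → Bool) → List A → ℕ
count p [] = zero
count p (a ∷ as) = if p a then suc (count p as) else count p as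

_==ᵇ_ : Bool → Bool → Bool
true  ==ᵇ b = b
false ==ᵇ b = not b

-- The EV protocol, abstracted to its pass/fail behaviour.
-- One round: an evaluator that knows the label (does not lie) always
-- passes; a lying evaluator evades detection with probability 1/4.

roundPass : (lies : Bool) → Dist Bool
roundPass true  = bernoulli ¼
roundPass false = return true

-- r rounds; the protocol fails (and stops) at the first failed challenge.
-- Result: success flag together with the evaluator's partial label ỹ.
evProtocol : (r : ℕ) (lies : Bool) (ỹ : Bool) → Dist (Bool × Bool)
evProtocol zero    lies ỹ = return (true , ỹ)
evProtocol (suc r) lies ỹ = roundPass lies >>= λ
  { true  → evProtocol r lies ỹ
  ; false → return (false , ỹ) }

-- The No-Data Algorithm.
-- f : true labelling, g : the evaluator's labelling.  The evaluator lies
-- on x iff it labels x incorrectly, i.e. iff g x ≠ f x.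

module _ {n : ℕ} (f g : Vec Bool n → Bool) where

  lies : Vec Bool n → Bool
  lies x = not (g x ==ᵇ f x)

  noDataPoint : (φ : ℚ) (r : ℕ) → Vec Bool n → Dist (Bool × Bool)
  noDataPoint φ r x = evProtocol r (lies x) (g x) >>= λ
    { (true  , y) → return (y , true)
    ; (false , y) → bernoulli φ >>= λ b →
                      return ((if b then not y else y) , false) }

  noDataAlgorithm : (φ : ℚ) (r : ℕ) → List (Vec Bool n) → Dist (List Bool × List Bool)
  noDataAlgorithm φ r [] = return ([] , [])
  noDataAlgorithm φ r (x ∷ xs) = noDataPoint φ r x >>= λ
    { (y , s) → noDataAlgorithm φ r xs >>= λ
      { (ys , ss) → return ((y ∷ ys) , (s ∷ ss)) } }

correctCount : {n : ℕ} → (Vec Bool n → Bool) → List (Vec Bool n) → List Bool → ℕ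
correctCount f [] _ = zero
correctCount f (x ∷ xs) [] = zero
correctCount f (x ∷ xs) (y ∷ ys) =
  if y ==ᵇ f x then suc (correctCount f xs ys) else correctCount f xs ys

{-# OPTIONS --safe #-}
-- Expectation is linear, so the expected accuracy is the average over X of the
-- probability that the output label on x is correct.  Where the evaluator is honest it
-- passes every round with the correct label; where it lies it is caught with probability
-- 1 - (1/4)^r, and only then is its wrong label flipped, with probability φ.
module Submission where

open import Defs
open import Data.Bool using (Bool; true; false; not; if_then_else_)
open import Data.List using (List; []; _∷_; _++_; map; length)
open import Data.List.Relation.Unary.Unique.Propositional using (Unique)
open import Data.Nat using (ℕ; zero; suc; NonZero)
import Data.Nat as ℕ
import Data.Nat.Properties as ℕₚ
open import Data.Integer using (+_)
import Data.Integer as ℤ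
import Data.Integer.Properties as ℤ
open import Data.Product using (_×_; _,_; proj₁)
open import Data.Rational using (ℚ; _/_; 0ℚ; 1ℚ; _-_; _*_; _+_; _≤_; toℚᵘ)
open import Data.Rational.Properties
  using ( +-identityˡ; +-identityʳ; *-identityˡ; *-identityʳ; +-assoc; *-zeroʳ; 0/n≡0; ≤-reflexive
        ; toℚᵘ-injective; toℚᵘ-fromℚᵘ; toℚᵘ-homo-+; fromℚᵘ-cong )
open import Data.Rational.Unnormalised as ℚᵘ using (mkℚᵘ; *≡*)
import Data.Rational.Unnormalised.Properties as ℚᵘ
open import Data.Rational.Solver using (module +-*-Solver)
open import Data.Vec using (Vec)
open import Relation.Binary.PropositionalEquality
  using (_≡_; refl; sym; trans; cong; cong₂; module ≡-Reasoning)

open +-*-Solver using (solve; _:+_; _:*_; _:-_; _:=_; con)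

+-distrib-/ : (a b m : ℕ) → + (a ℕ.+ b) / suc m ≡ + a / suc m + + b / suc m
+-distrib-/ a b m = toℚᵘ-injective (begin
  toℚᵘ (+ (a ℕ.+ b) / suc m)                  ≈⟨ toℚᵘ-fromℚᵘ (mkℚᵘ (+ (a ℕ.+ b)) m) ⟩
  mkℚᵘ (+ (a ℕ.+ b)) m                        ≈⟨ *≡* cross-multiplied ⟩
  mkℚᵘ (+ a) m ℚᵘ.+ mkℚᵘ (+ b) m              ≈⟨ ℚᵘ.+-cong (toℚᵘ-fromℚᵘ (mkℚᵘ (+ a) m))
                                                            (toℚᵘ-fromℚᵘ (mkℚᵘ (+ b) m)) ⟨
  toℚᵘ (+ a / suc m) ℚᵘ.+ toℚᵘ (+ b / suc m)  ≈⟨ toℚᵘ-homo-+ (+ a / suc m) (+ b / suc m) ⟨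
  toℚᵘ (+ a / suc m + + b / suc m)            ∎)
  where
  open ℚᵘ.≃-Reasoning
  cross-multiplied : + (a ℕ.+ b) ℤ.* (+ suc m ℤ.* + suc m)
                   ≡ (+ a ℤ.* + suc m ℤ.+ + b ℤ.* + suc m) ℤ.* + suc m
  cross-multiplied = trans (sym (ℤ.*-assoc (+ a ℤ.+ + b) (+ suc m) (+ suc m)))
                           (cong (ℤ._* + suc m) (ℤ.*-distribʳ-+ (+ suc m) (+ a) (+ b)))

n/n≡1 : (m : ℕ) → + suc m / suc m ≡ 1ℚ
n/n≡1 m = fromℚᵘ-cong {mkℚᵘ (+ suc m) m} {mkℚᵘ (+ 1) 0} (*≡* (ℤ.*-comm (+ suc m) (+ 1)))

1^ℚn≡1 : (r : ℕ) → 1ℚ ^ℚ r ≡ 1ℚ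
1^ℚn≡1 zero    = refl
1^ℚn≡1 (suc r) = trans (*-identityˡ (1ℚ ^ℚ r)) (1^ℚn≡1 r)

count+count-not≡length : {A : Set} (p : A → Bool) (X : List A) →
                         count p X ℕ.+ count (λ x → not (p x)) X ≡ length X
count+count-not≡length p []      = refl
count+count-not≡length p (x ∷ X) with p x
... | true  = cong suc (count+count-not≡length p X)
... | false = trans (ℕₚ.+-suc (count p X) _) (cong suc (count+count-not≡length p X))

count/n+count-not/n≡1 : {A : Set} (p : A → Bool) (X : List A) (m : ℕ) → length X ≡ suc m →
                        + count p X / suc m + + count (λ x → not (p x)) X / suc m ≡ 1ℚ
count/n+count-not/n≡1 p X m |X|≡n = begin
  + count p X / suc m + + count (λ x → not (p x)) X / suc m
    ≡⟨ +-distrib-/ (count p X) (count (λ x → not (p x)) X) m ⟨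
  + (count p X ℕ.+ count (λ x → not (p x)) X) / suc m
    ≡⟨ cong (λ k → + k / suc m) (trans (count+count-not≡length p X) |X|≡n) ⟩
  + suc m / suc m
    ≡⟨ n/n≡1 m ⟩
  1ℚ ∎
  where open ≡-Reasoning

module _ {A : Set} where

  𝔼-++ : (d e : Dist A) (h : A → ℚ) → 𝔼 (d ++ e) h ≡ 𝔼 d h + 𝔼 e h
  𝔼-++ []            e h = sym (+-identityˡ (𝔼 e h))
  𝔼-++ ((p , a) ∷ d) e h = trans (cong (_+_ (p * h a)) (𝔼-++ d e h)) (sym (+-assoc (p * h a) _ _))

  𝔼-cong : (d : Dist A) {h k : A → ℚ} → (∀ a → h a ≡ k a) → 𝔼 d h ≡ 𝔼 d k
  𝔼-cong []            h≗k = refl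
  𝔼-cong ((p , a) ∷ d) h≗k = cong₂ (λ x y → p * x + y) (h≗k a) (𝔼-cong d h≗k)

  𝔼-+ : (d : Dist A) (h k : A → ℚ) → 𝔼 d (λ a → h a + k a) ≡ 𝔼 d h + 𝔼 d k
  𝔼-+ []            h k = refl
  𝔼-+ ((p , a) ∷ d) h k = trans (cong (_+_ (p * (h a + k a))) (𝔼-+ d h k))
    (solve 5 (λ p x y u v → p :* (x :+ y) :+ (u :+ v) := (p :* x :+ u) :+ (p :* y :+ v))
      refl p (h a) (k a) (𝔼 d h) (𝔼 d k))

  𝔼-*ˡ : (d : Dist A) (c : ℚ) (h : A → ℚ) → 𝔼 d (λ a → c * h a) ≡ c * 𝔼 d h
  𝔼-*ˡ []            c h = sym (*-zeroʳ c)
  𝔼-*ˡ ((p , a) ∷ d) c h = trans (cong (_+_ (p * (c * h a))) (𝔼-*ˡ d c h))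
    (solve 4 (λ p c x u → p :* (c :* x) :+ c :* u := c :* (p :* x :+ u)) refl p c (h a) (𝔼 d h))

  𝔼-reweight : (p : ℚ) (d : Dist A) (h : A → ℚ) → 𝔼 (map (λ (q , a) → (p * q , a)) d) h ≡ p * 𝔼 d h
  𝔼-reweight p []            h = sym (*-zeroʳ p)
  𝔼-reweight p ((q , a) ∷ d) h = trans (cong (_+_ (p * q * h a)) (𝔼-reweight p d h))
    (solve 4 (λ p q x u → p :* q :* x :+ p :* u := p :* (q :* x :+ u)) refl p q (h a) (𝔼 d h))

  𝔼-return : (a : A) (h : A → ℚ) → 𝔼 (return a) h ≡ h a
  𝔼-return a h = trans (+-identityʳ (1ℚ * h a)) (*-identityˡ (h a))

  𝔼->>= : {B : Set} (d : Dist B) (k : B → Dist A) (h : A → ℚ) → 𝔼 (d >>= k) h ≡ 𝔼 d (λ b → 𝔼 (k b) h)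
  𝔼->>= []            k h = refl
  𝔼->>= ((p , b) ∷ d) k h =
    trans (𝔼-++ (map _ (k b)) (d >>= k) h) (cong₂ _+_ (𝔼-reweight p (k b) h) (𝔼->>= d k h))

  IsProb : Dist A → Set
  IsProb d = 𝔼 d (λ _ → 1ℚ) ≡ 1ℚ

  𝔼-const : (d : Dist A) → IsProb d → (c : ℚ) → 𝔼 d (λ _ → c) ≡ c
  𝔼-const d total c = begin
    𝔼 d (λ _ → c)        ≡⟨ 𝔼-cong d (λ _ → sym (*-identityʳ c)) ⟩
    𝔼 d (λ _ → c * 1ℚ)   ≡⟨ 𝔼-*ˡ d c (λ _ → 1ℚ) ⟩
    c * 𝔼 d (λ _ → 1ℚ)   ≡⟨ cong (c *_) total ⟩
    c * 1ℚ               ≡⟨ *-identityʳ c ⟩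
    c                    ∎
    where open ≡-Reasoning

  𝔼-+-const : (d : Dist A) → IsProb d → (c : ℚ) (h : A → ℚ) → 𝔼 d (λ a → c + h a) ≡ c + 𝔼 d h
  𝔼-+-const d total c h = trans (𝔼-+ d (λ _ → c) h) (cong (_+ 𝔼 d h) (𝔼-const d total c))

  return-isProb : (a : A) → IsProb (return a)
  return-isProb a = 𝔼-return a (λ _ → 1ℚ)

>>=-isProb : {A B : Set} (d : Dist A) (k : A → Dist B) →
             IsProb d → (∀ a → IsProb (k a)) → IsProb (d >>= k)
>>=-isProb d k total-d total-k = trans (𝔼->>= d k (λ _ → 1ℚ)) (trans (𝔼-cong d total-k) total-d)

𝔼-bernoulli : (p : ℚ) (h : Bool → ℚ) → 𝔼 (bernoulli p) h ≡ p * h true + (1ℚ - p) * h false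
𝔼-bernoulli p h = cong (_+_ (p * h true)) (+-identityʳ ((1ℚ - p) * h false))

roundPassProb : Bool → ℚ
roundPassProb true  = ¼
roundPassProb false = 1ℚ

𝔼-roundPass : (l : Bool) (h : Bool → ℚ) →
              𝔼 (roundPass l) h ≡ roundPassProb l * h true + (1ℚ - roundPassProb l) * h false
𝔼-roundPass true  h = 𝔼-bernoulli ¼ h
𝔼-roundPass false h =
  solve 2 (λ x y → con 1ℚ :* x :+ con 0ℚ := con 1ℚ :* x :+ (con 1ℚ :- con 1ℚ) :* y) refl (h true) (h false)

𝔼-evProtocol : (r : ℕ) (l y : Bool) (h : Bool × Bool → ℚ) → let p = roundPassProb l ^ℚ r in
               𝔼 (evProtocol r l y) h ≡ p * h (true , y) + (1ℚ - p) * h (false , y)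
𝔼-evProtocol zero    l y h = trans (𝔼-return (true , y) h)
  (solve 2 (λ a b → a := con 1ℚ :* a :+ (con 1ℚ :- con 1ℚ) :* b) refl (h (true , y)) (h (false , y)))
𝔼-evProtocol (suc r) l y h = begin
  𝔼 (evProtocol (suc r) l y) h
    ≡⟨ trans (𝔼->>= (roundPass l) _ h) (𝔼-roundPass l _) ⟩
  s * 𝔼 (evProtocol r l y) h + (1ℚ - s) * 𝔼 (return (false , y)) h
    ≡⟨ cong₂ (λ x z → s * x + (1ℚ - s) * z) (𝔼-evProtocol r l y h) (𝔼-return (false , y) h) ⟩
  s * (p * a + (1ℚ - p) * b) + (1ℚ - s) * b
    ≡⟨ solve 4 (λ s p a b → s :* (p :* a :+ (con 1ℚ :- p) :* b) :+ (con 1ℚ :- s) :* b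
                            := s :* p :* a :+ (con 1ℚ :- s :* p) :* b) refl s p a b ⟩
  s * p * a + (1ℚ - s * p) * b ∎
  where
  open ≡-Reasoning
  s = roundPassProb l
  p = s ^ℚ r
  a = h (true , y)
  b = h (false , y)

honest : {n : ℕ} (f g : Vec Bool n → Bool) → Vec Bool n → Bool
honest f g x = g x ==ᵇ f x

module _ {n : ℕ} (f g : Vec Bool n → Bool) (φ : ℚ) (r : ℕ) where

  𝔼-noDataPoint : (x : Vec Bool n) (h : Bool × Bool → ℚ) → let p = roundPassProb (lies f g x) ^ℚ r in
    𝔼 (noDataPoint f g φ r x) h
      ≡ p * h (g x , true) + (1ℚ - p) * (φ * h (not (g x) , false) + (1ℚ - φ) * h (g x , false))
  𝔼-noDataPoint x h = begin
    𝔼 (noDataPoint f g φ r x) h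
      ≡⟨ trans (𝔼->>= (evProtocol r (lies f g x) (g x)) _ h) (𝔼-evProtocol r (lies f g x) (g x) _) ⟩
    p * 𝔼 (return (g x , true)) h + (1ℚ - p) * 𝔼 (bernoulli φ >>= flipWith) h
      ≡⟨ cong₂ (λ u v → p * u + (1ℚ - p) * v) (𝔼-return (g x , true) h) 𝔼-flip ⟩
    p * h (g x , true) + (1ℚ - p) * (φ * h (not (g x) , false) + (1ℚ - φ) * h (g x , false)) ∎
    where
    open ≡-Reasoning
    p = roundPassProb (lies f g x) ^ℚ r
    flipWith : Bool → Dist (Bool × Bool)
    flipWith b = return ((if b then not (g x) else g x) , false)
    𝔼-flip : 𝔼 (bernoulli φ >>= flipWith) h ≡ φ * h (not (g x) , false) + (1ℚ - φ) * h (g x , false)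
    𝔼-flip = trans (𝔼->>= (bernoulli φ) flipWith h) (trans (𝔼-bernoulli φ (λ b → 𝔼 (flipWith b) h))
      (cong₂ (λ u v → φ * u + (1ℚ - φ) * v) (𝔼-return (not (g x) , false) h) (𝔼-return (g x , false) h)))

  noDataPoint-isProb : (x : Vec Bool n) → IsProb (noDataPoint f g φ r x)
  noDataPoint-isProb x = trans (𝔼-noDataPoint x (λ _ → 1ℚ))
    (solve 2 (λ p φ → p :* con 1ℚ :+ (con 1ℚ :- p) :* (φ :* con 1ℚ :+ (con 1ℚ :- φ) :* con 1ℚ) := con 1ℚ)
      refl (roundPassProb (lies f g x) ^ℚ r) φ)

  prepend : Bool × Bool → List Bool × List Bool → Dist (List Bool × List Bool)
  prepend (y , s) (ys , ss) = return (y ∷ ys , s ∷ ss)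

  runTail : List (Vec Bool n) → Bool × Bool → Dist (List Bool × List Bool)
  runTail xs ys = noDataAlgorithm f g φ r xs >>= prepend ys

  noDataAlgorithm-isProb : (X : List (Vec Bool n)) → IsProb (noDataAlgorithm f g φ r X)
  noDataAlgorithm-isProb []       = return-isProb {A = List Bool × List Bool} ([] , [])
  noDataAlgorithm-isProb (x ∷ xs) =
    >>=-isProb (noDataPoint f g φ r x) (runTail xs) (noDataPoint-isProb x) λ (y , s) →
      >>=-isProb (noDataAlgorithm f g φ r xs) (prepend (y , s)) (noDataAlgorithm-isProb xs) λ (ys , ss) →
        return-isProb {A = List Bool × List Bool} (y ∷ ys , s ∷ ss)

  𝟙 : Bool → ℚ
  𝟙 true  = 1ℚ
  𝟙 false = 0ℚ

  correctProb : Bool → ℚ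
  correctProb true  = 1ℚ
  correctProb false = (1ℚ - ¼ ^ℚ r) * φ

  noDataPoint-correct : (x : Vec Bool n) →
    𝔼 (noDataPoint f g φ r x) (λ (y , _) → 𝟙 (y ==ᵇ f x)) ≡ correctProb (honest f g x)
  noDataPoint-correct x = trans (𝔼-noDataPoint x _) (byCases (g x) (f x))
    where
    honestCase : let p = 1ℚ ^ℚ r in p * 1ℚ + (1ℚ - p) * (φ * 0ℚ + (1ℚ - φ) * 1ℚ) ≡ 1ℚ
    honestCase = trans (cong (λ p → p * 1ℚ + (1ℚ - p) * (φ * 0ℚ + (1ℚ - φ) * 1ℚ)) (1^ℚn≡1 r))
      (solve 1 (λ φ → con 1ℚ :* con 1ℚ :+ (con 1ℚ :- con 1ℚ) :* (φ :* con 0ℚ :+ (con 1ℚ :- φ) :* con 1ℚ)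
                      := con 1ℚ) refl φ)
    lyingCase : let q = ¼ ^ℚ r in q * 0ℚ + (1ℚ - q) * (φ * 1ℚ + (1ℚ - φ) * 0ℚ) ≡ (1ℚ - q) * φ
    lyingCase = solve 2 (λ q φ → q :* con 0ℚ :+ (con 1ℚ :- q) :* (φ :* con 1ℚ :+ (con 1ℚ :- φ) :* con 0ℚ)
                                 := (con 1ℚ :- q) :* φ) refl (¼ ^ℚ r) φ
    byCases : (y t : Bool) → let p = roundPassProb (not (y ==ᵇ t)) ^ℚ r in
      p * 𝟙 (y ==ᵇ t) + (1ℚ - p) * (φ * 𝟙 (not y ==ᵇ t) + (1ℚ - φ) * 𝟙 (y ==ᵇ t)) ≡ correctProb (y ==ᵇ t)
    byCases true  true  = honestCase
    byCases false false = honestCase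
    byCases true  false = lyingCase
    byCases false true  = lyingCase

  module _ (m : ℕ) where

    accuracy : List (Vec Bool n) → List Bool → ℚ
    accuracy X ys = + correctCount f X ys / suc m

    accuracy-∷ : (x : Vec Bool n) (xs : List (Vec Bool n)) (y : Bool) (ys : List Bool) →
                 accuracy (x ∷ xs) (y ∷ ys) ≡ + 1 / suc m * 𝟙 (y ==ᵇ f x) + accuracy xs ys
    accuracy-∷ x xs y ys with y ==ᵇ f x
    ... | true  = trans (+-distrib-/ 1 (correctCount f xs ys) m)
                        (cong (_+ accuracy xs ys) (sym (*-identityʳ (+ 1 / suc m))))
    ... | false = sym (trans (cong (_+ accuracy xs ys) (*-zeroʳ (+ 1 / suc m))) (+-identityˡ (accuracy xs ys)))

    𝔼-accuracy-∷ : (x : Vec Bool n) (xs : List (Vec Bool n)) →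
      𝔼 (noDataAlgorithm f g φ r (x ∷ xs)) (λ (ys , _) → accuracy (x ∷ xs) ys)
        ≡ + 1 / suc m * correctProb (honest f g x) + 𝔼 (noDataAlgorithm f g φ r xs) (λ (ys , _) → accuracy xs ys)
    𝔼-accuracy-∷ x xs = begin
      𝔼 (noDataAlgorithm f g φ r (x ∷ xs)) H
        ≡⟨ 𝔼->>= point (runTail xs) H ⟩
      𝔼 point (λ ys → 𝔼 (runTail xs ys) H)
        ≡⟨ 𝔼-cong point (λ (y , s) → 𝔼-runTail y s) ⟩
      𝔼 point (λ (y , _) → u * 𝟙 (y ==ᵇ f x) + rest)
        ≡⟨ 𝔼-+ point (λ (y , _) → u * 𝟙 (y ==ᵇ f x)) (λ _ → rest) ⟩
      𝔼 point (λ (y , _) → u * 𝟙 (y ==ᵇ f x)) + 𝔼 point (λ _ → rest)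
        ≡⟨ cong₂ _+_ (trans (𝔼-*ˡ point u _) (cong (u *_) (noDataPoint-correct x)))
                     (𝔼-const point (noDataPoint-isProb x) rest) ⟩
      u * correctProb (honest f g x) + rest ∎
      where
      open ≡-Reasoning
      u = + 1 / suc m
      point = noDataPoint f g φ r x
      tail = noDataAlgorithm f g φ r xs
      H : List Bool × List Bool → ℚ
      H (ys , _) = accuracy (x ∷ xs) ys
      rest = 𝔼 tail (λ (ys , _) → accuracy xs ys)
      𝔼-runTail : (y s : Bool) → 𝔼 (runTail xs (y , s)) H ≡ u * 𝟙 (y ==ᵇ f x) + rest
      𝔼-runTail y s = trans (𝔼->>= tail (prepend (y , s)) H)
        (trans (𝔼-cong tail λ (ys , ss) → trans (𝔼-return (y ∷ ys , s ∷ ss) H) (accuracy-∷ x xs y ys))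
               (𝔼-+-const tail (noDataAlgorithm-isProb xs) (u * 𝟙 (y ==ᵇ f x)) _))

    expectedAccuracy : (X : List (Vec Bool n)) →
      𝔼 (noDataAlgorithm f g φ r X) (λ (ys , _) → accuracy X ys)
        ≡ + count (honest f g) X / suc m + + count (lies f g) X / suc m * correctProb false
    expectedAccuracy []       = begin
      𝔼 (noDataAlgorithm f g φ r []) (λ (ys , _) → accuracy [] ys)
        ≡⟨ 𝔼-return {A = List Bool × List Bool} ([] , []) (λ (ys , _) → accuracy [] ys) ⟩
      + 0 / suc m
        ≡⟨ 0/n≡0 (suc m) ⟩
      0ℚ
        ≡⟨ solve 1 (λ t → con 0ℚ := con 0ℚ :+ con 0ℚ :* t) refl (correctProb false) ⟩
      0ℚ + 0ℚ * correctProb false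
        ≡⟨ cong (λ z → z + z * correctProb false) (0/n≡0 (suc m)) ⟨
      + 0 / suc m + + 0 / suc m * correctProb false ∎
      where open ≡-Reasoning
    expectedAccuracy (x ∷ xs) = trans (𝔼-accuracy-∷ x xs)
      (trans (cong (_+_ (u * correctProb (honest f g x))) (expectedAccuracy xs))
             (count-∷ (honest f g x) (count (honest f g) xs) (count (lies f g) xs)))
      where
      open ≡-Reasoning
      u = + 1 / suc m
      t = correctProb false
      count-∷ : (b : Bool) (i j : ℕ) → u * correctProb b + (+ i / suc m + + j / suc m * t)
                ≡ + (if b then suc i else i) / suc m + + (if not b then suc j else j) / suc m * t
      count-∷ true  i j = begin
        u * 1ℚ + (h + l * t)
          ≡⟨ solve 4 (λ u h l t → u :* con 1ℚ :+ (h :+ l :* t) := (u :+ h) :+ l :* t) refl u h l t ⟩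
        (u + h) + l * t
          ≡⟨ cong (λ z → z + l * t) (+-distrib-/ 1 i m) ⟨
        + suc i / suc m + l * t ∎
        where h = + i / suc m
              l = + j / suc m
      count-∷ false i j = begin
        u * t + (h + l * t)
          ≡⟨ solve 4 (λ u h l t → u :* t :+ (h :+ l :* t) := h :+ (u :+ l) :* t) refl u h l t ⟩
        h + (u + l) * t
          ≡⟨ cong (λ z → h + z * t) (+-distrib-/ 1 j m) ⟨
        h + + suc j / suc m * t ∎
        where h = + i / suc m
              l = + j / suc m

theorem1 : {n : ℕ} (X : List (Vec Bool n)) (N : ℕ) .{{_ : NonZero N}}
           (f g : Vec Bool n → Bool) (α φ : ℚ) (r : ℕ) →
           Unique X → length X ≡ N →
           count (λ x → f x) X ≡ count (λ x → not (f x)) X →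
           α ≡ (+ count (λ x → g x ==ᵇ f x) X) / N →
           0ℚ ≤ φ → φ ≤ 1ℚ →
           𝔼 (noDataAlgorithm f g φ r X) (λ res → (+ correctCount f X (proj₁ res)) / N)
             ≤ 1ℚ - (1ℚ - α) * ((1ℚ - φ) + φ * (¼ ^ℚ r))
theorem1 X (suc m) f g _ φ r _ |X|≡N _ refl _ _ = ≤-reflexive (begin
  𝔼 (noDataAlgorithm f g φ r X) (λ (ys , _) → accuracy f g φ r m X ys)
    ≡⟨ expectedAccuracy f g φ r m X ⟩
  a + b * ((1ℚ - q) * φ)
    ≡⟨ solve 4 (λ a b q φ → a :+ b :* ((con 1ℚ :- q) :* φ)
                           := (a :+ b) :- ((a :+ b) :- a) :* ((con 1ℚ :- φ) :+ φ :* q)) refl a b q φ ⟩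
  (a + b) - ((a + b) - a) * ((1ℚ - φ) + φ * q)
    ≡⟨ cong (λ o → o - (o - a) * ((1ℚ - φ) + φ * q)) (count/n+count-not/n≡1 (honest f g) X m |X|≡N) ⟩
  1ℚ - (1ℚ - a) * ((1ℚ - φ) + φ * q) ∎)
  where
  open ≡-Reasoning
  q = ¼ ^ℚ r
  a = + count (honest f g) X / suc m
  b = + count (lies f g) X / suc m
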